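{- Let $G$ be a finite simple undirected graph and let $C_1,C_2\in\mathcal{C}_{\mathcal{R}}$ be short loop-interchangeable. Let $\mathcal{M}_1$ be an MCB with $C_1\in\mathcal{M}_1$. Then $\mathcal{M}_2=(\mathcal{M}_1\setminus\{C_1\})\cup\{C_2\}$ is an MCB.
   Context: Let $G=(V,E)$ be a finite simple undirected graph. A cycle is a set $C\subseteq E$ such that every vertex of $G$ has even degree in the subgraph with edge set $C$; $|C|$ denotes the number of edges. The cycles form a vector space over $GF(2)$ under symmetric difference $\oplus$. A minimum cycle basis (MCB) is a basis $\mathcal{M}$ of this space minimizing $\sum_{B\in\mathcal{M}}|B|$. The set of relevant cycles $\mathcal{C}_{\mathcal{R}}$ is the union of all MCBs. Two cycles $C_1,C_2\in\mathcal{C}_{\mathcal{R}}$ with $|C_1|=|C_2|$ are short loop-interchangeable if there is a finite set $\mathcal{Y}$ of cycles, each of length $<|C_1|$, with $C_1=C_2\oplus\bigoplus_{C\in\mathcal{Y}}C$. -}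

module Defs where

open import Data.Nat using (ℕ; zero; suc; _+_; _<_; _≤_)
open import Data.Nat.Divisibility using (_∣_)
open import Data.Bool using (Bool; true; false; if_then_else_; _xor_; _∨_)
open import Data.Fin using (Fin; zero; suc; _≟_)
open import Data.Fin.Subset using (Subset; ∣_∣; _∩_) renaming (⊥ to ∅)
open import Data.Vec using (Vec; []; _∷_; zipWith; tabulate)
open import Data.Product using (Σ; _×_; _,_; proj₁; proj₂; ∃; ∃-syntax)
open import Data.Sum using (_⊎_)
open import Data.List using (List; foldr)
open import Data.List.Relation.Unary.All using (All)
open import Relation.Binary.PropositionalEquality using (_≡_; _≢_)
open import Relation.Nullary.Decidable using (⌊_⌋)

record Graph : Set where
  field
    n m   : ℕ
    ends  : Fin m → Fin n × Fin n
    loopless : ∀ e → proj₁ (ends e) ≢ proj₂ (ends e)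
    noMulti  : ∀ e e' →
      (  (proj₁ (ends e) ≡ proj₁ (ends e') × proj₂ (ends e) ≡ proj₂ (ends e'))
       ⊎ (proj₁ (ends e) ≡ proj₂ (ends e') × proj₂ (ends e) ≡ proj₁ (ends e')))
      → e ≡ e'
open Graph public

EdgeSet : Graph → Set
EdgeSet G = Subset (m G)

_⊕_ : ∀ {k} → Subset k → Subset k → Subset k
_⊕_ = zipWith _xor_

incident : (G : Graph) → Fin (n G) → EdgeSet G
incident G v = tabulate λ e → ⌊ v ≟ proj₁ (ends G e) ⌋ ∨ ⌊ v ≟ proj₂ (ends G e) ⌋

degree : (G : Graph) → EdgeSet G → Fin (n G) → ℕ
degree G C v = ∣ C ∩ incident G v ∣

IsCycle : (G : Graph) → EdgeSet G → Set
IsCycle G C = ∀ v → 2 ∣ degree G C v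

⊕List : ∀ {k} → List (Subset k) → Subset k
⊕List = foldr _⊕_ ∅

Family : Graph → ℕ → Set
Family G k = Fin k → EdgeSet G

lin : ∀ {G k} → Family G k → Subset k → Subset (m G)
lin {k = zero}  B []      = ∅
lin {G} {suc k} B (x ∷ s) = (if x then B zero else ∅) ⊕ lin {G} (λ i → B (suc i)) s

weight : ∀ {G k} → Family G k → ℕ
weight {k = zero}  B = 0
weight {G} {suc k} B = ∣ B zero ∣ + weight {G} (λ i → B (suc i))

IsCycleBasis : (G : Graph) → ∀ {k} → Family G k → Set
IsCycleBasis G {k} B =
    (∀ i → IsCycle G (B i))
  × (∀ s → lin {G} B s ≡ ∅ → s ≡ ∅)
  × (∀ C → IsCycle G C → ∃[ s ] lin {G} B s ≡ C)

IsMCB : (G : Graph) → ∀ {k} → Family G k → Set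
IsMCB G {k} B = IsCycleBasis G B
  × (∀ k' (B' : Family G k') → IsCycleBasis G B' → weight {G} B ≤ weight {G} B')

IsRelevant : (G : Graph) → EdgeSet G → Set
IsRelevant G C = ∃[ k ] Σ (Family G k) λ B → IsMCB G {k} B × ∃[ i ] B i ≡ C

ShortLoopInterchangeable : (G : Graph) → EdgeSet G → EdgeSet G → Set
ShortLoopInterchangeable G C₁ C₂ =
    IsRelevant G C₁ × IsRelevant G C₂ × ∣ C₁ ∣ ≡ ∣ C₂ ∣
  × Σ (List (EdgeSet G)) λ Y →
      All (λ C → IsCycle G C × ∣ C ∣ < ∣ C₁ ∣) Y × C₁ ≡ C₂ ⊕ ⊕List Y

replace : ∀ G {k} → Family G k → Fin k → EdgeSet G → Family G k
replace G B i C j = if ⌊ j ≟ i ⌋ then C else B j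

{-# OPTIONS --safe #-}
module Submission where

-- Steinitz exchange: if a cycle C is represented in a basis B with coefficient 1 at B j,
-- then replacing B j by C is again a basis.  In an MCB every basis cycle occurring in
-- the representation of a cycle y is at most as long as y, since otherwise exchanging it
-- for y would give a lighter basis.  Hence the sum D of the short cycles of Y is
-- represented without M₁ i, so C₂ = C₁ ⊕ D is represented with coefficient 1 at M₁ i;
-- the exchange yields a basis, of the same weight because |C₂| = |C₁|.

open import Defs
open import Data.Fin using (Fin)
open import Data.Product using (∃-syntax)
open import Relation.Binary.PropositionalEquality using (_≡_)

open import Level using (0ℓ)
open import Algebra.Bundles using (CommutativeSemigroup)
import Algebra.Properties.CommutativeSemigroup as CommutativeSemigroupProperties
open import Data.Bool using (Bool; true; false; if_then_else_; _xor_; not)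
open import Data.Bool.Properties using (xor-assoc; xor-comm; xor-identityˡ; xor-identityʳ; xor-same; ¬-not)
open import Data.Fin using (zero; suc; _≟_)
open import Data.Fin.Subset using (Subset; ∣_∣; ⁅_⁆) renaming (⊥ to ∅)
open import Data.Fin.Subset.Properties using (x∈⁅x⁆)
open import Data.List using ([]; _∷_)
open import Data.List.Relation.Unary.All using (All; []; _∷_)
open import Data.Nat using (ℕ; zero; suc; _+_; _<_; _≤_)
open import Data.Nat.Properties using (+-commutativeSemigroup; +-assoc; +-cancelʳ-≡; +-monoˡ-≤; +-monoʳ-<; <-irrefl; <⇒≱; ≮⇒≥; module ≤-Reasoning)
open import Data.Product using (_×_; _,_; proj₁; proj₂)
open import Data.Vec using (lookup; _∷_; [])
open import Data.Vec.Properties using (zipWith-assoc; zipWith-comm; zipWith-identityˡ; zipWith-identityʳ; lookup-zipWith; lookup-replicate; []=⇒lookup)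
open import Relation.Binary.PropositionalEquality using (_≗_; refl; sym; trans; cong; cong₂; subst; module ≡-Reasoning)
open import Relation.Binary.PropositionalEquality.Algebra using (isMagma)
open import Relation.Nullary using (yes; no; ¬_)
open import Relation.Nullary.Decidable using (⌊_⌋)

open CommutativeSemigroupProperties +-commutativeSemigroup using (xy∙z≈zy∙x)

⊕-assoc : ∀ {k} (a b c : Subset k) → (a ⊕ b) ⊕ c ≡ a ⊕ (b ⊕ c)
⊕-assoc = zipWith-assoc xor-assoc

⊕-comm : ∀ {k} (a b : Subset k) → a ⊕ b ≡ b ⊕ a
⊕-comm = zipWith-comm xor-comm

⊕-identityˡ : ∀ {k} (a : Subset k) → ∅ ⊕ a ≡ a
⊕-identityˡ = zipWith-identityˡ xor-identityˡ

⊕-identityʳ : ∀ {k} (a : Subset k) → a ⊕ ∅ ≡ a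
⊕-identityʳ = zipWith-identityʳ xor-identityʳ

⊕-self : ∀ {k} (a : Subset k) → a ⊕ a ≡ ∅
⊕-self []      = refl
⊕-self (x ∷ a) = cong₂ _∷_ (xor-same x) (⊕-self a)

⊕-commutativeSemigroup : ℕ → CommutativeSemigroup 0ℓ 0ℓ
⊕-commutativeSemigroup k = record
  { Carrier = Subset k
  ; _≈_ = _≡_
  ; _∙_ = _⊕_
  ; isCommutativeSemigroup = record
    { isSemigroup = record { isMagma = isMagma _⊕_ ; assoc = ⊕-assoc }
    ; comm = ⊕-comm
    }
  }

⊕-interchange : ∀ {k} (a b c d : Subset k) → (a ⊕ b) ⊕ (c ⊕ d) ≡ (a ⊕ c) ⊕ (b ⊕ d)
⊕-interchange {k} = CommutativeSemigroupProperties.interchange (⊕-commutativeSemigroup k)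

⊕-cancelʳ : ∀ {k} (a b : Subset k) → (a ⊕ b) ⊕ b ≡ a
⊕-cancelʳ a b = begin
  (a ⊕ b) ⊕ b  ≡⟨ ⊕-assoc a b b ⟩
  a ⊕ (b ⊕ b)  ≡⟨ cong (a ⊕_) (⊕-self b) ⟩
  a ⊕ ∅        ≡⟨ ⊕-identityʳ a ⟩
  a            ∎
  where open ≡-Reasoning

lookup-⊕ : ∀ {k} (a b : Subset k) j → lookup (a ⊕ b) j ≡ lookup a j xor lookup b j
lookup-⊕ a b j = lookup-zipWith _xor_ j a b

lookup-⁅⁆ : ∀ {k} (j : Fin k) → lookup ⁅ j ⁆ j ≡ true
lookup-⁅⁆ j = []=⇒lookup (x∈⁅x⁆ j)

lookup-⁅⁆-⊕ : ∀ {k} j (t : Subset k) → lookup (⁅ j ⁆ ⊕ t) j ≡ not (lookup t j)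
lookup-⁅⁆-⊕ j t = trans (lookup-⊕ ⁅ j ⁆ t j) (cong (_xor lookup t j) (lookup-⁅⁆ j))

-- Scalar multiplication over GF(2); `lin` is defined with it unfolded.
infixr 30 _·_

_·_ : ∀ {k} → Bool → Subset k → Subset k
b · a = if b then a else ∅

·-distrib-xor : ∀ {k} x y (a : Subset k) → (x xor y) · a ≡ x · a ⊕ y · a
·-distrib-xor true  true  a = sym (⊕-self a)
·-distrib-xor true  false a = sym (⊕-identityʳ a)
·-distrib-xor false true  a = sym (⊕-identityˡ a)
·-distrib-xor false false a = sym (⊕-identityˡ ∅)

⌊suc≟suc⌋ : ∀ {k} (i j : Fin k) → ⌊ suc i ≟ suc j ⌋ ≡ ⌊ i ≟ j ⌋
⌊suc≟suc⌋ i j with i ≟ j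
... | yes _ = refl
... | no _  = refl

module _ (G : Graph) where

  lin-ext : ∀ {k} (B B′ : Family G k) → B ≗ B′ → ∀ s → lin {G} B s ≡ lin {G} B′ s
  lin-ext {zero}  B B′ B≗B′ []      = refl
  lin-ext {suc k} B B′ B≗B′ (x ∷ s) =
    cong₂ (λ b c → x · b ⊕ c) (B≗B′ zero)
          (lin-ext (λ i → B (suc i)) (λ i → B′ (suc i)) (λ i → B≗B′ (suc i)) s)

  weight-ext : ∀ {k} (B B′ : Family G k) → B ≗ B′ → weight {G} B ≡ weight {G} B′
  weight-ext {zero}  B B′ B≗B′ = refl
  weight-ext {suc k} B B′ B≗B′ =
    cong₂ _+_ (cong ∣_∣ (B≗B′ zero))
              (weight-ext (λ i → B (suc i)) (λ i → B′ (suc i)) (λ i → B≗B′ (suc i)))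

  lin-∅ : ∀ {k} (B : Family G k) → lin {G} B ∅ ≡ ∅
  lin-∅ {zero}  B = refl
  lin-∅ {suc k} B = trans (⊕-identityˡ _) (lin-∅ (λ i → B (suc i)))

  lin-⊕ : ∀ {k} (B : Family G k) s t → lin {G} B (s ⊕ t) ≡ lin {G} B s ⊕ lin {G} B t
  lin-⊕ {zero}  B []      []      = sym (⊕-identityˡ ∅)
  lin-⊕ {suc k} B (x ∷ s) (y ∷ t) = begin
    (x xor y) · B zero ⊕ lin {G} B′ (s ⊕ t)
      ≡⟨ cong₂ _⊕_ (·-distrib-xor x y (B zero)) (lin-⊕ B′ s t) ⟩
    (x · B zero ⊕ y · B zero) ⊕ (lin {G} B′ s ⊕ lin {G} B′ t)
      ≡⟨ ⊕-interchange _ _ _ _ ⟩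
    (x · B zero ⊕ lin {G} B′ s) ⊕ (y · B zero ⊕ lin {G} B′ t)
      ∎
    where
    open ≡-Reasoning
    B′ : Family G k
    B′ i = B (suc i)

  lin-· : ∀ {k} (B : Family G k) b s → lin {G} B (b · s) ≡ b · lin {G} B s
  lin-· B true  s = refl
  lin-· B false s = lin-∅ B

  lin-⁅⁆ : ∀ {k} (B : Family G k) j → lin {G} B ⁅ j ⁆ ≡ B j
  lin-⁅⁆ {suc k} B zero    = trans (cong (B zero ⊕_) (lin-∅ (λ i → B (suc i)))) (⊕-identityʳ _)
  lin-⁅⁆ {suc k} B (suc j) = trans (⊕-identityˡ _) (lin-⁅⁆ (λ i → B (suc i)) j)

  replace-suc : ∀ {k} (B : Family G (suc k)) j C i →
    replace G B (suc j) C (suc i) ≡ replace G (λ i → B (suc i)) j C i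
  replace-suc B j C i = cong (λ b → if b then C else B (suc i)) (⌊suc≟suc⌋ i j)

  lin-replace : ∀ {k} (B : Family G k) j C s →
    lin {G} (replace G B j C) s ≡ lin {G} B s ⊕ lookup s j · (B j ⊕ C)
  lin-replace {suc k} B zero C (true ∷ s) = sym (begin
    (B zero ⊕ L) ⊕ (B zero ⊕ C)  ≡⟨ ⊕-interchange (B zero) L (B zero) C ⟩
    (B zero ⊕ B zero) ⊕ (L ⊕ C)  ≡⟨ cong (_⊕ (L ⊕ C)) (⊕-self (B zero)) ⟩
    ∅ ⊕ (L ⊕ C)                  ≡⟨ ⊕-identityˡ (L ⊕ C) ⟩
    L ⊕ C                        ≡⟨ ⊕-comm L C ⟩
    C ⊕ L                        ∎)
    where
    open ≡-Reasoning
    L : EdgeSet G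
    L = lin {G} (λ i → B (suc i)) s
  lin-replace {suc k} B zero    C (false ∷ s) = sym (⊕-identityʳ _)
  lin-replace {suc k} B (suc j) C (x ∷ s)     = begin
    x · B zero ⊕ lin {G} (λ i → replace G B (suc j) C (suc i)) s
      ≡⟨ cong (x · B zero ⊕_) (lin-ext _ _ (replace-suc B j C) s) ⟩
    x · B zero ⊕ lin {G} (replace G B′ j C) s
      ≡⟨ cong (x · B zero ⊕_) (lin-replace B′ j C s) ⟩
    x · B zero ⊕ (lin {G} B′ s ⊕ lookup s j · (B′ j ⊕ C))
      ≡⟨ ⊕-assoc _ _ _ ⟨
    (x · B zero ⊕ lin {G} B′ s) ⊕ lookup s j · (B′ j ⊕ C)
      ∎
    where
    open ≡-Reasoning
    B′ : Family G k
    B′ i = B (suc i)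

  weight-replace : ∀ {k} (B : Family G k) j C →
    weight {G} (replace G B j C) + ∣ B j ∣ ≡ weight {G} B + ∣ C ∣
  weight-replace {suc k} B zero    C = xy∙z≈zy∙x (∣ C ∣) (weight {G} (λ i → B (suc i))) (∣ B zero ∣)
  weight-replace {suc k} B (suc j) C = begin
    (∣ B zero ∣ + weight {G} (λ i → replace G B (suc j) C (suc i))) + ∣ B′ j ∣
      ≡⟨ +-assoc (∣ B zero ∣) _ _ ⟩
    ∣ B zero ∣ + (weight {G} (λ i → replace G B (suc j) C (suc i)) + ∣ B′ j ∣)
      ≡⟨ cong (λ w → ∣ B zero ∣ + (w + ∣ B′ j ∣)) (weight-ext _ _ (replace-suc B j C)) ⟩
    ∣ B zero ∣ + (weight {G} (replace G B′ j C) + ∣ B′ j ∣)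
      ≡⟨ cong (∣ B zero ∣ +_) (weight-replace B′ j C) ⟩
    ∣ B zero ∣ + (weight {G} B′ + ∣ C ∣)
      ≡⟨ +-assoc (∣ B zero ∣) _ _ ⟨
    (∣ B zero ∣ + weight {G} B′) + ∣ C ∣
      ∎
    where
    open ≡-Reasoning
    B′ : Family G k
    B′ i = B (suc i)

  replace-isCycleBasis : ∀ {k} {B : Family G k} {j C} t → IsCycleBasis G B → IsCycle G C →
    lin {G} B t ≡ C → lookup t j ≡ true → IsCycleBasis G (replace G B j C)
  replace-isCycleBasis {k} {B} {j} {C} t (cycles , independent , spanning) C-cycle t↦C tⱼ =
    cycles′ , independent′ , spanning′
    where
    open ≡-Reasoning

    w : Subset k
    w = ⁅ j ⁆ ⊕ t

    -- Coordinates w.r.t. the exchanged basis, rewritten w.r.t. B; an involution since tⱼ = 1.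
    φ : Subset k → Subset k
    φ s = s ⊕ lookup s j · w

    lookup-·w : ∀ b → lookup (b · w) j ≡ false
    lookup-·w true  = trans (lookup-⁅⁆-⊕ j t) (cong not tⱼ)
    lookup-·w false = lookup-replicate j false

    lookup-φ : ∀ s → lookup (φ s) j ≡ lookup s j
    lookup-φ s = begin
      lookup (φ s) j                                ≡⟨ lookup-⊕ s _ j ⟩
      lookup s j xor lookup (lookup s j · w) j      ≡⟨ cong (lookup s j xor_) (lookup-·w (lookup s j)) ⟩
      lookup s j xor false                          ≡⟨ xor-identityʳ _ ⟩
      lookup s j                                    ∎

    φ-involutive : ∀ s → φ (φ s) ≡ s
    φ-involutive s = trans (cong (λ b → φ s ⊕ b · w) (lookup-φ s)) (⊕-cancelʳ s _)

    φ-∅ : φ ∅ ≡ ∅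
    φ-∅ = trans (cong (λ b → ∅ ⊕ b · w) (lookup-replicate j false)) (⊕-identityʳ ∅)

    lin-φ : ∀ s → lin {G} (replace G B j C) s ≡ lin {G} B (φ s)
    lin-φ s = begin
      lin {G} (replace G B j C) s                               ≡⟨ lin-replace B j C s ⟩
      lin {G} B s ⊕ sⱼ · (B j ⊕ C)                              ≡⟨ cong (λ c → lin {G} B s ⊕ sⱼ · c) (cong₂ _⊕_ (lin-⁅⁆ B j) t↦C) ⟨
      lin {G} B s ⊕ sⱼ · (lin {G} B ⁅ j ⁆ ⊕ lin {G} B t)        ≡⟨ cong (λ c → lin {G} B s ⊕ sⱼ · c) (lin-⊕ B ⁅ j ⁆ t) ⟨
      lin {G} B s ⊕ sⱼ · lin {G} B w                            ≡⟨ cong (lin {G} B s ⊕_) (lin-· B sⱼ w) ⟨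
      lin {G} B s ⊕ lin {G} B (sⱼ · w)                          ≡⟨ lin-⊕ B s (sⱼ · w) ⟨
      lin {G} B (φ s)                                           ∎
      where
      sⱼ : Bool
      sⱼ = lookup s j

    cycles′ : ∀ l → IsCycle G (replace G B j C l)
    cycles′ l with ⌊ l ≟ j ⌋
    ... | true  = C-cycle
    ... | false = cycles l

    independent′ : ∀ s → lin {G} (replace G B j C) s ≡ ∅ → s ≡ ∅
    independent′ s s↦∅ = begin
      s          ≡⟨ φ-involutive s ⟨
      φ (φ s)    ≡⟨ cong φ (independent (φ s) (trans (sym (lin-φ s)) s↦∅)) ⟩
      φ ∅        ≡⟨ φ-∅ ⟩
      ∅          ∎

    spanning′ : ∀ D → IsCycle G D → ∃[ s ] lin {G} (replace G B j C) s ≡ D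
    spanning′ D D-cycle =
      let u , u↦D = spanning D D-cycle
      in φ u , trans (lin-φ (φ u)) (trans (cong (lin {G} B) (φ-involutive u)) u↦D)

  weight-replace-sameLength : ∀ {k} (B : Family G k) j C → ∣ C ∣ ≡ ∣ B j ∣ →
    weight {G} (replace G B j C) ≡ weight {G} B
  weight-replace-sameLength B j C same =
    +-cancelʳ-≡ (∣ B j ∣) _ _ (trans (weight-replace B j C) (cong (weight {G} B +_) same))

  isMCB-sameWeight : ∀ {k k′} {B : Family G k} {B′ : Family G k′} → IsMCB G B →
    IsCycleBasis G B′ → weight {G} B′ ≡ weight {G} B → IsMCB G B′
  isMCB-sameWeight (_ , minimal) basis′ same =
    basis′ , λ k″ B″ basis″ → subst (_≤ weight {G} B″) (sym same) (minimal k″ B″ basis″)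

  isMCB-support-shorter : ∀ {k} {M : Family G k} {y} s → IsMCB G M → IsCycle G y →
    lin {G} M s ≡ y → ∀ l → lookup s l ≡ true → ∣ M l ∣ ≤ ∣ y ∣
  isMCB-support-shorter {k} {M} {y} s (basis , minimal) y-cycle s↦y l sₗ = ≮⇒≥ y≮Mₗ
    where
    y≮Mₗ : ¬ ∣ y ∣ < ∣ M l ∣
    y≮Mₗ y<Mₗ = <-irrefl refl (begin-strict
      weight {G} M + ∣ M l ∣                   ≤⟨ +-monoˡ-≤ (∣ M l ∣) (minimal k _ exchanged) ⟩
      weight {G} (replace G M l y) + ∣ M l ∣   ≡⟨ weight-replace M l y ⟩
      weight {G} M + ∣ y ∣                     <⟨ +-monoʳ-< (weight {G} M) y<Mₗ ⟩
      weight {G} M + ∣ M l ∣                   ∎)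
      where
      open ≤-Reasoning
      exchanged : IsCycleBasis G (replace G M l y)
      exchanged = replace-isCycleBasis s basis y-cycle s↦y sₗ

  isMCB-⊕List-shorter-avoids : ∀ {k} {M : Family G k} i → IsMCB G M →
    ∀ {Y} → All (λ C → IsCycle G C × ∣ C ∣ < ∣ M i ∣) Y →
    ∃[ t ] lin {G} M t ≡ ⊕List Y × lookup t i ≡ false
  isMCB-⊕List-shorter-avoids {M = M} i mcb [] = ∅ , lin-∅ M , lookup-replicate i false
  isMCB-⊕List-shorter-avoids {M = M} i mcb {y ∷ Y} ((y-cycle , y<Mᵢ) ∷ shorter)
    with proj₂ (proj₂ (proj₁ mcb)) y y-cycle | isMCB-⊕List-shorter-avoids i mcb shorter
  ... | s , s↦y | t , t↦Y , tᵢ =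
    s ⊕ t , trans (lin-⊕ M s t) (cong₂ _⊕_ s↦y t↦Y) , trans (lookup-⊕ s t i) (cong₂ _xor_ sᵢ tᵢ)
    where
    sᵢ : lookup s i ≡ false
    sᵢ = ¬-not (λ sᵢ≡true → <⇒≱ y<Mᵢ (isMCB-support-shorter s mcb y-cycle s↦y i sᵢ≡true))

  relevant⇒cycle : ∀ {C} → IsRelevant G C → IsCycle G C
  relevant⇒cycle (_ , B , mcb , i , Bᵢ≡C) = subst (IsCycle G) Bᵢ≡C (proj₁ (proj₁ mcb) i)

corollary3 : (G : Graph) (C₁ C₂ : EdgeSet G) → ShortLoopInterchangeable G C₁ C₂
    → ∀ {k} (M₁ : Family G k) → IsMCB G M₁ → (i : Fin k) → M₁ i ≡ C₁
    → IsMCB G (replace G M₁ i C₂)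
corollary3 G .(M₁ i) C₂ (_ , C₂-relevant , sameLength , Y , shorter , M₁ᵢ≡C₂⊕Y) M₁ mcb i refl
  with isMCB-⊕List-shorter-avoids G i mcb shorter
... | t , t↦Y , tᵢ =
  isMCB-sameWeight G mcb exchanged (weight-replace-sameLength G M₁ i C₂ (sym sameLength))
  where
  open ≡-Reasoning
  ⁅i⁆⊕t↦C₂ : lin {G} M₁ (⁅ i ⁆ ⊕ t) ≡ C₂
  ⁅i⁆⊕t↦C₂ = begin
    lin {G} M₁ (⁅ i ⁆ ⊕ t)              ≡⟨ lin-⊕ G M₁ ⁅ i ⁆ t ⟩
    lin {G} M₁ ⁅ i ⁆ ⊕ lin {G} M₁ t     ≡⟨ cong₂ _⊕_ (lin-⁅⁆ G M₁ i) t↦Y ⟩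
    M₁ i ⊕ ⊕List Y                      ≡⟨ cong (_⊕ ⊕List Y) M₁ᵢ≡C₂⊕Y ⟩
    (C₂ ⊕ ⊕List Y) ⊕ ⊕List Y            ≡⟨ ⊕-cancelʳ C₂ (⊕List Y) ⟩
    C₂                                  ∎
  exchanged : IsCycleBasis G (replace G M₁ i C₂)
  exchanged = replace-isCycleBasis G (⁅ i ⁆ ⊕ t) (proj₁ mcb) (relevant⇒cycle G C₂-relevant)
                ⁅i⁆⊕t↦C₂ (trans (lookup-⁅⁆-⊕ i t) (cong not tᵢ))
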